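{- Let $\ell\ge1$ and $n$ be integers, let $T$ be an $n$-vertex tree for which $k=k(T)$ is defined. Then $T$ contains a subtree that is a $k$-vine, and every subtree of $T$ that is a $k$-vine has fewer than $n-\ell$ vertices.
   Context: A $j$-vine is a tree of diameter $2j$ and a $j$-evine is a tree of diameter $2j+1$. For an $n$-vertex tree $T$ (and fixed $\ell$), $k(T)$ is the largest integer $j\ge0$ such that $T$ contains a subtree that is a $j$-evine and every subtree of $T$ that is a $j$-evine has fewer than $n-\ell$ vertices; $k(T)$ is defined when such a $j$ exists. -}

module Defs where

open import Data.Nat using (ℕ; zero; suc; _+_; _*_; _≤_; _<_)
open import Data.Fin using (Fin)
open import Data.Fin.Subset using (Subset; _∈_; ⊤; ∣_∣)
open import Data.List using (List; []; _∷_)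
open import Data.List.Relation.Unary.Unique.Propositional using (Unique)
open import Data.Product using (Σ; ∃; _×_; _,_)
open import Relation.Binary.PropositionalEquality using (_≡_)
open import Relation.Nullary using (¬_)

record Graph (n : ℕ) : Set₁ where
  field
    Adj     : Fin n → Fin n → Set
    sym     : ∀ {u v} → Adj u v → Adj v u
    irrefl  : ∀ {u} → ¬ Adj u u

module _ {n : ℕ} (G : Graph n) where
  open Graph G

  data Walk (S : Subset n) : Fin n → Fin n → ℕ → Set where
    here : ∀ {u} → u ∈ S → Walk S u u 0
    step : ∀ {u w v k} → u ∈ S → Adj u w → Walk S w v k → Walk S u v (suc k)

  verts : ∀ {S u v k} → Walk S u v k → List (Fin n)
  verts (here {u} _)        = u ∷ []
  verts (step {u} _ _ rest) = u ∷ verts rest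

  IsPath : ∀ {S u v k} → Walk S u v k → Set
  IsPath w = Unique (verts w)

  Connected : Subset n → Set
  Connected S = ∀ u v → u ∈ S → v ∈ S → ∃ λ k → Walk S u v k

  IsTree : Set
  IsTree = Connected ⊤ ×
           (∀ {u v k k'} (p : Walk ⊤ u v k) (q : Walk ⊤ u v k') →
              IsPath p → IsPath q → verts p ≡ verts q)

  -- A subtree: a nonempty vertex set inducing a connected subgraph
  -- (an induced connected subgraph of a tree is a tree).
  IsSubtree : Subset n → Set
  IsSubtree S = (∃ λ u → u ∈ S) × Connected S

  DistLe : Subset n → Fin n → Fin n → ℕ → Set
  DistLe S u v d = ∃ λ k → Walk S u v k × k ≤ d

  DistGe : Subset n → Fin n → Fin n → ℕ → Set
  DistGe S u v d = ∀ {k} → Walk S u v k → d ≤ k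

  HasDiameter : Subset n → ℕ → Set
  HasDiameter S d =
    (∀ u v → u ∈ S → v ∈ S → DistLe S u v d) ×
    (∃ λ u → ∃ λ v → u ∈ S × v ∈ S × DistGe S u v d)

  IsVine : ℕ → Subset n → Set
  IsVine j S = IsSubtree S × HasDiameter S (2 * j)

  IsEvine : ℕ → Subset n → Set
  IsEvine j S = IsSubtree S × HasDiameter S (suc (2 * j))

  KCond : ℕ → ℕ → Set
  KCond ℓ j = (∃ λ S → IsEvine j S) × (∀ S → IsEvine j S → ∣ S ∣ + ℓ < n)

  -- k(T) is defined and equals k: k is the largest j satisfying KCond.
  IsK : ℕ → ℕ → Set
  IsK ℓ k = KCond ℓ k × (∀ j → KCond ℓ j → j ≤ k)

-- A diametral path of a k-evine, with its last edge removed, spans a k-vine.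
-- Conversely, suppose a k-vine D has at least n − ℓ vertices. Add vertices of T
-- to D one neighbour at a time: each step keeps the vertex set connected and raises
-- the diameter by at most one. Because paths in a tree are unique, distances inside
-- a subtree are distances in T, so the whole of T has diameter ≥ 2k + 1 (it contains
-- a k-evine). Hence some step produces a k-evine containing D; it has at least
-- n − ℓ vertices, which the definition of k(T) forbids.
module Submission where

open import Defs
open import Data.Nat using (ℕ; zero; suc; _+_; _≤_; _<_; z≤n; s≤s; _<?_)
open import Data.Nat.Properties
  using (≤-refl; ≤-trans; ≤-antisym; ≤-pred; ≤-reflexive; m≤n⇒m≤1+n; m≤n⇒m<n∨m≡n; +-identityʳ; ≰⇒>; ≮⇒≥; <⇒≱; +-suc; +-monoˡ-≤; m≤n+m)
open import Data.Fin using (Fin; _≟_)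
open import Data.Fin.Properties using (any?; all?; ¬∀⟶∃¬)
open import Data.Fin.Subset using (Subset; _∈_; _∉_; _⊆_; ⊥; ∣_∣; ⁅_⁆; _∪_)
open import Data.Fin.Subset.Properties
  using (_∈?_; ∉⊥; ∈⊤; ⊆⊤; ⊆-trans; x∈⁅x⁆; x∈⁅y⁆⇒x≡y; x∈p∪q⁺; x∈p∪q⁻; p⊆p∪q; p⊆q⇒∣p∣≤∣q∣; p⊂q⇒∣p∣<∣q∣; ∣⊤∣≡n)
open import Data.List using (List; []; _∷_)
open import Data.List.Membership.Propositional using () renaming (_∈_ to _∈L_)
open import Data.List.Relation.Unary.Any using (here; there)
open import Data.List.Relation.Unary.All using ([])
open import Data.List.Relation.Unary.All.Properties using (¬Any⇒All¬)
open import Data.List.Relation.Unary.AllPairs using ([]; _∷_)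
open import Data.List.Relation.Unary.Unique.Propositional using (Unique)
open import Data.Product using (Σ; ∃; ∃₂; _×_; _,_; proj₁; proj₂)
open import Data.Sum using (_⊎_; inj₁; inj₂)
open import Data.Empty using (⊥-elim)
open import Relation.Binary.Definitions using (Decidable)
open import Relation.Binary.PropositionalEquality using (_≡_; refl; sym; trans; cong; subst)
open import Relation.Nullary using (¬_; Dec; yes; no; ¬?)
open import Relation.Nullary.Decidable using (_×-dec_; map′; decidable-stable; ¬¬-excluded-middle)

¬¬-∀-Fin : ∀ {m} {P : Fin m → Set} → (∀ i → ¬ ¬ P i) → ¬ ¬ (∀ i → P i)
¬¬-∀-Fin {zero}  _   k = k (λ ())
¬¬-∀-Fin {suc m} ¬¬P k =
  ¬¬P Fin.zero λ P₀ → ¬¬-∀-Fin (λ i → ¬¬P (Fin.suc i)) λ Pₛ →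
    k λ { Fin.zero → P₀ ; (Fin.suc i) → Pₛ i }

fromList : ∀ {n} → List (Fin n) → Subset n
fromList []       = ⊥
fromList (x ∷ xs) = ⁅ x ⁆ ∪ fromList xs

∈-fromList⁺ : ∀ {n} {x : Fin n} {xs} → x ∈L xs → x ∈ fromList xs
∈-fromList⁺ (here refl) = x∈p∪q⁺ (inj₁ (x∈⁅x⁆ _))
∈-fromList⁺ (there x∈) = x∈p∪q⁺ (inj₂ (∈-fromList⁺ x∈))

∈-fromList⁻ : ∀ {n} {x : Fin n} xs → x ∈ fromList xs → x ∈L xs
∈-fromList⁻ []       x∈ = ⊥-elim (∉⊥ x∈)
∈-fromList⁻ (y ∷ xs) x∈ with x∈p∪q⁻ ⁅ y ⁆ (fromList xs) x∈
... | inj₁ x∈⁅y⁆ = here (x∈⁅y⁆⇒x≡y y x∈⁅y⁆)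
... | inj₂ x∈xs  = there (∈-fromList⁻ xs x∈xs)

x∈p∪⁅x⁆ : ∀ {n} (p : Subset n) x → x ∈ p ∪ ⁅ x ⁆
x∈p∪⁅x⁆ _ x = x∈p∪q⁺ (inj₂ (x∈⁅x⁆ x))

∣p∣<∣p∪⁅x⁆∣ : ∀ {n} {p : Subset n} {x} → x ∉ p → ∣ p ∣ < ∣ p ∪ ⁅ x ⁆ ∣
∣p∣<∣p∪⁅x⁆∣ {p = p} {x} x∉p = p⊂q⇒∣p∣<∣q∣ (p⊆p∪q {p = p} ⁅ x ⁆ , x , x∈p∪⁅x⁆ p x , x∉p)

x∉p⇒∣p∣<n : ∀ {n} {p : Subset n} {x} → x ∉ p → ∣ p ∣ < n
x∉p⇒∣p∣<n {n} {p} {x} x∉p = subst (∣ p ∣ <_) (∣⊤∣≡n n) (p⊂q⇒∣p∣<∣q∣ (⊆⊤ , x , ∈⊤ , x∉p))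

module _ {n : ℕ} (G : Graph n) where
  open Graph G renaming (sym to Adj-sym)
  open import Data.List.Membership.DecPropositional (_≟_ {n}) using () renaming (_∈?_ to _∈L?_)

  verts⊆ : ∀ {S u v k} (w : Walk G S u v k) {x} → x ∈L verts G w → x ∈ S
  verts⊆ (here u∈)     (here refl) = u∈
  verts⊆ (step u∈ _ _) (here refl) = u∈
  verts⊆ (step _ _ w)  (there x∈)  = verts⊆ w x∈

  head∈verts : ∀ {S u v k} (w : Walk G S u v k) → u ∈L verts G w
  head∈verts (here _)     = here refl
  head∈verts (step _ _ _) = here refl

  last∈verts : ∀ {S u v k} (w : Walk G S u v k) → v ∈L verts G w
  last∈verts (here _)     = here refl
  last∈verts (step _ _ w) = there (last∈verts w)

  restrict : ∀ {A B u v k} (w : Walk G A u v k) → (∀ {x} → x ∈L verts G w → x ∈ B) → Walk G B u v k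
  restrict (here _)     ⊆B = here (⊆B (here refl))
  restrict (step _ e w) ⊆B = step (⊆B (here refl)) e (restrict w (λ x∈ → ⊆B (there x∈)))

  verts-restrict : ∀ {A B u v k} (w : Walk G A u v k) (⊆B : ∀ {x} → x ∈L verts G w → x ∈ B) →
                   verts G (restrict w ⊆B) ≡ verts G w
  verts-restrict (here _)     _  = refl
  verts-restrict (step _ _ w) ⊆B = cong (_ ∷_) (verts-restrict w (λ x∈ → ⊆B (there x∈)))

  weaken : ∀ {A B u v k} → A ⊆ B → Walk G A u v k → Walk G B u v k
  weaken A⊆B w = restrict w (λ x∈ → A⊆B (verts⊆ w x∈))

  snoc : ∀ {S u v w k} → Walk G S u v k → Adj v w → w ∈ S → Walk G S u w (suc k)
  snoc (here u∈)      vw w∈ = step u∈ vw (here w∈)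
  snoc (step u∈ e ws) vw w∈ = step u∈ e (snoc ws vw w∈)

  unsnoc : ∀ {S u w k} → Walk G S u w (suc k) → ∃ λ v → Walk G S u v k × Adj v w
  unsnoc {k = zero}  (step u∈ e (here _)) = _ , here u∈ , e
  unsnoc {k = suc k} (step u∈ e ws) =
    let (v , wv , vw) = unsnoc ws in v , step u∈ e wv , vw

  path-suffix : ∀ {S u v k} (p : Walk G S u v k) → IsPath G p → ∀ {x} → x ∈L verts G p →
                ∃ λ k′ → k′ ≤ k × Σ (Walk G S x v k′) (IsPath G)
  path-suffix p@(here _)     up (here refl) = _ , ≤-refl , p , up
  path-suffix p@(step _ _ _) up (here refl) = _ , ≤-refl , p , up
  path-suffix (step _ _ p)   (_ ∷ up) (there x∈) =
    let (k′ , k′≤ , q , uq) = path-suffix p up x∈ in k′ , m≤n⇒m≤1+n k′≤ , q , uq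

  shorten-to-path : ∀ {S u v k} (w : Walk G S u v k) → ∃ λ k′ → k′ ≤ k × Σ (Walk G S u v k′) (IsPath G)
  shorten-to-path (here u∈) = 0 , z≤n , here u∈ , [] ∷ []
  shorten-to-path (step {u = u} u∈ e w) with shorten-to-path w
  ... | k′ , k′≤ , p , up with u ∈L? verts G p
  ... | yes u∈p = let (k″ , k″≤ , q , uq) = path-suffix p up u∈p in
                  k″ , m≤n⇒m≤1+n (≤-trans k″≤ k′≤) , q , uq
  ... | no  u∉p = suc k′ , s≤s k′≤ , step u∈ e p , ¬Any⇒All¬ _ u∉p ∷ up

  subwalk : ∀ {A u v m} (w : Walk G A u v m) {V} → (∀ {x} → x ∈L verts G w → x ∈ V) →
            ∀ {a b} → a ∈L verts G w → b ∈L verts G w → DistLe G V a b m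
  subwalk (here _)     ⊆V (here refl) (here refl) = 0 , here (⊆V (here refl)) , z≤n
  subwalk (step _ e w) ⊆V (here refl) (here refl) = 0 , here (⊆V (here refl)) , z≤n
  subwalk (step _ e w) ⊆V (here refl) (there b∈) =
    let (j , X , j≤) = subwalk w (λ x∈ → ⊆V (there x∈)) (head∈verts w) b∈ in
    suc j , step (⊆V (here refl)) e X , s≤s j≤
  subwalk (step _ e w) ⊆V (there a∈) (here refl) =
    let (j , X , j≤) = subwalk w (λ x∈ → ⊆V (there x∈)) a∈ (head∈verts w) in
    suc j , snoc X (Adj-sym e) (⊆V (here refl)) , s≤s j≤
  subwalk (step _ e w) ⊆V (there a∈) (there b∈) =
    let (j , X , j≤) = subwalk w (λ x∈ → ⊆V (there x∈)) a∈ b∈ in j , X , m≤n⇒m≤1+n j≤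

  diameter⇒connected : ∀ {S d} → HasDiameter G S d → Connected G S
  diameter⇒connected (le , _) u v u∈ v∈ = let (k , w , _) = le u v u∈ v∈ in k , w

  diameter⇒subtree : ∀ {S d} → HasDiameter G S d → IsSubtree G S
  diameter⇒subtree diam@(_ , u , _ , u∈ , _) = (u , u∈) , diameter⇒connected diam

  exit-edge : ∀ {A} D {u v k} → u ∈ D → v ∉ D → Walk G A u v k → ∃₂ λ y z → y ∈ D × z ∉ D × Adj y z
  exit-edge D u∈ v∉ (here _) = ⊥-elim (v∉ u∈)
  exit-edge D u∈ v∉ (step {w = w} _ e ws) with w ∈? D
  ... | yes w∈ = exit-edge D w∈ v∉ ws
  ... | no  w∉ = _ , w , u∈ , w∉ , e

  diameter-pred : ∀ {S d} → HasDiameter G S (suc d) → ∃ λ V → HasDiameter G V d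
  diameter-pred {S} {d} (le , a , b , a∈ , b∈ , ge) with le a b a∈ b∈
  ... | m , w , m≤ with ≤-antisym m≤ (ge w)
  ... | refl with unsnoc w
  ... | c , w′ , cb = V , upper , a , c , ∈-fromList⁺ (head∈verts w′) , ∈-fromList⁺ (last∈verts w′) , lower
    where
    V = fromList (verts G w′)
    upper : ∀ u v → u ∈ V → v ∈ V → DistLe G V u v d
    upper u v u∈ v∈ = subwalk w′ ∈-fromList⁺ (∈-fromList⁻ _ u∈) (∈-fromList⁻ _ v∈)
    lower : DistGe G V a c d
    lower X = ≤-pred (ge (snoc (weaken (λ x∈ → verts⊆ w′ (∈-fromList⁻ _ x∈)) X) cb b∈))

  weaken-insert : ∀ {D u v j} z → Walk G D u v j → Walk G (D ∪ ⁅ z ⁆) u v j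
  weaken-insert z = weaken (p⊆p∪q ⁅ z ⁆)

  insert-distLe : ∀ {D d y z} → (∀ a b → a ∈ D → b ∈ D → DistLe G D a b d) → y ∈ D → Adj y z →
                  ∀ a b → a ∈ D ∪ ⁅ z ⁆ → b ∈ D ∪ ⁅ z ⁆ → DistLe G (D ∪ ⁅ z ⁆) a b (suc d)
  insert-distLe {D} {d} {y} {z} le y∈ yz a b a∈ b∈ with x∈p∪q⁻ D ⁅ z ⁆ a∈ | x∈p∪q⁻ D ⁅ z ⁆ b∈
  ... | inj₁ a∈D | inj₁ b∈D = let (j , X , j≤) = le a b a∈D b∈D in j , weaken-insert z X , m≤n⇒m≤1+n j≤
  ... | inj₁ a∈D | inj₂ b∈z with refl ← x∈⁅y⁆⇒x≡y z b∈z =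
    let (j , X , j≤) = le a y a∈D y∈ in suc j , snoc (weaken-insert z X) yz (x∈p∪⁅x⁆ D z) , s≤s j≤
  ... | inj₂ a∈z | inj₁ b∈D with refl ← x∈⁅y⁆⇒x≡y z a∈z =
    let (j , X , j≤) = le y b y∈ b∈D in suc j , step (x∈p∪⁅x⁆ D z) (Adj-sym yz) (weaken-insert z X) , s≤s j≤
  ... | inj₂ a∈z | inj₂ b∈z with refl ← x∈⁅y⁆⇒x≡y z a∈z | refl ← x∈⁅y⁆⇒x≡y z b∈z =
    0 , here (x∈p∪⁅x⁆ D z) , z≤n

  module _ (tree : IsTree G) where

    -- Both walks shorten to paths, which coincide by uniqueness of paths in a tree.
    shortcut : ∀ {A S u v m} → Connected G S → u ∈ S → v ∈ S → Walk G A u v m → DistLe G S u v m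
    shortcut {S = S} conn u∈ v∈ w with shorten-to-path (weaken ⊆⊤ w) | conn _ _ u∈ v∈
    ... | k , k≤ , p , up | _ , q₀ with shorten-to-path q₀
    ... | _ , _ , q , uq = k , restrict p p⊆S , k≤
      where
      q⊤ = weaken ⊆⊤ q
      same-verts : verts G p ≡ verts G q
      same-verts = trans (proj₂ tree p q⊤ up (subst Unique (sym (verts-restrict q _)) uq))
                         (verts-restrict q _)
      p⊆S : ∀ {x} → x ∈L verts G p → x ∈ S
      p⊆S x∈ = verts⊆ q (subst (_ ∈L_) same-verts x∈)

    distGe-transfer : ∀ {S A u v d} → Connected G S → u ∈ S → v ∈ S → DistGe G S u v d → DistGe G A u v d
    distGe-transfer conn u∈ v∈ ge w = let (_ , w′ , k≤) = shortcut conn u∈ v∈ w in ≤-trans (ge w′) k≤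

    full-diameter-≥ : ∀ {D d E e} → (∀ x → x ∈ D) → HasDiameter G D d → HasDiameter G E e → e ≤ d
    full-diameter-≥ full (leD , _) diamE@(_ , a , b , a∈ , b∈ , geE) =
      let (m , w , m≤) = leD a b (full a) (full b) in
      ≤-trans (distGe-transfer (diameter⇒connected diamE) a∈ b∈ geE w) m≤

    module _ (Adj? : Decidable Adj) where

      walk? : ∀ S u v k → Dec (Walk G S u v k)
      walk? S u v zero with u ≟ v | u ∈? S
      ... | yes refl | yes u∈ = yes (here u∈)
      ... | yes refl | no  u∉ = no λ { (here u∈) → u∉ u∈ }
      ... | no  u≢v  | _      = no λ { (here _) → u≢v refl }
      walk? S u v (suc k) with u ∈? S | any? (λ w → Adj? u w ×-dec walk? S w v k)
      ... | yes u∈ | yes (_ , e , ws) = yes (step u∈ e ws)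
      ... | yes _  | no  ∄           = no λ { (step _ e ws) → ∄ (_ , e , ws) }
      ... | no  u∉ | _               = no λ { (step u∈ _ _) → u∉ u∈ }

      distLe? : ∀ S u v d → Dec (DistLe G S u v d)
      distLe? S u v zero = map′ (λ w → 0 , w , z≤n) (λ { (_ , w , z≤n) → w }) (walk? S u v 0)
      distLe? S u v (suc d) with walk? S u v (suc d) | distLe? S u v d
      ... | yes w | _               = yes (_ , w , ≤-refl)
      ... | no  _ | yes (k , w , k≤) = yes (k , w , m≤n⇒m≤1+n k≤)
      ... | no ∄w | no ∄short        = no not-within
        where
        not-within : ¬ DistLe G S u v (suc d)
        not-within (k , w , k≤) with m≤n⇒m<n∨m≡n k≤
        ... | inj₁ k<d+1 = ∄short (k , w , ≤-pred k<d+1)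
        ... | inj₂ refl  = ∄w w

      insert-diameter : ∀ {D d y z} → HasDiameter G D d → y ∈ D → Adj y z →
                        HasDiameter G (D ∪ ⁅ z ⁆) d ⊎ HasDiameter G (D ∪ ⁅ z ⁆) (suc d)
      insert-diameter {D} {d} {y} {z} diamD@(le , p , q , p∈ , q∈ , ge) y∈ yz
        with any? (λ u → any? (λ v → u ∈? D′ ×-dec v ∈? D′ ×-dec ¬? (distLe? D′ u v d)))
        where D′ = D ∪ ⁅ z ⁆
      ... | yes (u , v , u∈ , v∈ , far) =
        inj₂ (insert-distLe le y∈ yz , u , v , u∈ , v∈ , λ w → ≰⇒> (λ k≤d → far (_ , w , k≤d)))
      ... | no ∄far =
        inj₁ ( (λ u v u∈ v∈ → decidable-stable (distLe? _ u v d) (λ far → ∄far (u , v , u∈ , v∈ , far)))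
             , p , q , p⊆p∪q {p = D} ⁅ z ⁆ p∈ , p⊆p∪q {p = D} ⁅ z ⁆ q∈
             , distGe-transfer (diameter⇒connected diamD) p∈ q∈ ge )

      enlarge-diameter : ∀ {E e D d} → HasDiameter G E e → d < e → HasDiameter G D d →
                         ∃ λ D′ → D ⊆ D′ × HasDiameter G D′ (suc d)
      enlarge-diameter {D = D} {d} diamE d<e = grow n (m≤n+m n ∣ D ∣)
        where
        grow : ∀ f {D} → n ≤ ∣ D ∣ + f → HasDiameter G D d → ∃ λ D′ → D ⊆ D′ × HasDiameter G D′ (suc d)
        grow f {D} big diamD@(_ , p , _ , p∈ , _) with all? (_∈? D)
        ... | yes full = ⊥-elim (<⇒≱ d<e (full-diameter-≥ full diamD diamE))
        ... | no ¬full with ¬∀⟶∃¬ n _ (_∈? D) ¬full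
        ... | x , x∉ with exit-edge D p∈ x∉ (proj₂ (proj₁ tree p x ∈⊤ ∈⊤))
        ... | y , z , y∈ , z∉ , yz with f | insert-diameter diamD y∈ yz
        ... | zero  | _         = ⊥-elim (<⇒≱ (x∉p⇒∣p∣<n x∉) (≤-trans big (≤-reflexive (+-identityʳ _))))
        ... | suc f | inj₂ diam′ = _ , p⊆p∪q {p = D} ⁅ z ⁆ , diam′
        ... | suc f | inj₁ diam′ =
          let (D″ , D′⊆ , diam″) = grow f big′ diam′ in D″ , ⊆-trans (p⊆p∪q {p = D} ⁅ z ⁆) D′⊆ , diam″
          where
          big′ : n ≤ ∣ D ∪ ⁅ z ⁆ ∣ + f
          big′ = ≤-trans big (≤-trans (≤-reflexive (+-suc ∣ D ∣ f)) (+-monoˡ-≤ f (∣p∣<∣p∪⁅x⁆∣ z∉)))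

lemma2p8 : (ℓ n : ℕ) → 1 ≤ ℓ → (T : Graph n) → IsTree T → (k : ℕ) → IsK T ℓ k →
    (∃ λ S → IsVine T k S) × (∀ S → IsVine T k S → ∣ S ∣ + ℓ < n)
lemma2p8 ℓ n _ T tree k (((_ , _ , diamE) , small) , _) = vine , vines-small
  where
  vine : ∃ λ S → IsVine T k S
  vine = let (V , diamV) = diameter-pred T diamE in V , diameter⇒subtree T diamV , diamV

  -- Adjacency need not be decidable, but the goal is, so a decision procedure may be assumed.
  vines-small : ∀ S → IsVine T k S → ∣ S ∣ + ℓ < n
  vines-small S (_ , diamS) = decidable-stable (∣ S ∣ + ℓ <? n) λ ¬fits →
    ¬¬-∀-Fin (λ _ → ¬¬-∀-Fin (λ _ → ¬¬-excluded-middle)) λ Adj? →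
      let (D , S⊆D , diamD) = enlarge-diameter T tree Adj? diamE ≤-refl diamS in
      <⇒≱ (small D (diameter⇒subtree T diamD , diamD))
          (≤-trans (≮⇒≥ ¬fits) (+-monoˡ-≤ ℓ (p⊆q⇒∣p∣≤∣q∣ S⊆D)))
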